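{- If $\emptyset\ne V\subseteq W\subseteq[N]$, then \[\kappa_V(W)=\sum_{\pi\in\Pi_V(W)}(-1)^{|\pi|-1}\chi_V(\pi)\mu_\pi,\qquad\text{where }\chi_V(\pi)=\begin{cases}1&\text{if }|\pi|=1,\\ d_\pi(V)\,(|\pi|-2)!&\text{if }|\pi|\ge2.\end{cases}\]
   Context: $\Gamma=(\Omega,\mathcal X)$ is a hypergraph on a finite set $\Omega$, $\mathbf p\in(0,1)^\Omega$, $\Omega_{\mathbf p}$ the random subset containing each $\omega$ independently with probability $p_\omega$. Edges are ordered $\gamma_1,\dots,\gamma_N$; $X_i$ is the indicator of $\gamma_i\subseteq\Omega_{\mathbf p}$; $X_V=\prod_{i\in V}X_i$. The dependency graph $G_\Gamma$ on $[N]$ joins $i\ne j$ iff $\gamma_i\cap\gamma_j\ne\emptyset$. For a set $\pi$ of subsets of $[N]$, $\mu_\pi=\prod_{P\in\pi}\mathbb E[X_P]$. For $\emptyset\ne V\subseteq W$: $\Pi^{\mathsf C}_V(W)$ is the set of partitions $\pi$ of $W$ having a part $P\supseteq V$ such that $V$ is a union of connected components of $G_\Gamma[P]$; $\kappa_V(W)=\sum_{\pi\in\Pi^{\mathsf C}_V(W)}(-1)^{|\pi|-1}(|\pi|-1)!\mu_\pi$; $\Pi_V(W)$ is the set of partitions of $W$ having $V$ as a part. For a partition $\pi$ and a part $P\in\pi$, the degree $d_\pi(P)$ is the number of parts $P'\in\pi\setminus\{P\}$ such that $G_\Gamma$ has an edge between $P'$ and $P$.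
   Formalization: The probabilities $p_\omega$ are rational. -}

module Defs where

open import Data.Bool.Base using (Bool; true; false; _∧_; _∨_; not; if_then_else_)
open import Data.Nat.Base using (ℕ; zero; suc; _!; pred)
open import Data.Fin.Base using (Fin)
open import Data.Fin.Properties using (_≟_)
open import Data.Fin.Subset using (Subset)
open import Data.Vec.Base using (lookup)
open import Data.List.Base using (List; []; _∷_; [_]; map; concatMap; filterᵇ; foldr; length)
open import Data.Bool.ListAction using (any; all)
open import Data.List using (allFin)
open import Data.Integer.Base using (+_)
open import Data.Rational.Base using (ℚ; _+_; _*_; -_; 0ℚ; 1ℚ; _/_)
open import Relation.Nullary.Decidable using (⌊_⌋)

ℕ→ℚ : ℕ → ℚ
ℕ→ℚ n = (+ n) / 1

sgn : ℕ → ℚ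
sgn zero = 1ℚ
sgn (suc k) = - sgn k

Σℚ : {A : Set} → List A → (A → ℚ) → ℚ
Σℚ xs f = foldr (λ x acc → f x + acc) 0ℚ xs

Πℚ : {A : Set} → List A → (A → ℚ) → ℚ
Πℚ xs f = foldr (λ x acc → f x * acc) 1ℚ xs

Σℚ-if : {A : Set} → List A → (A → Bool) → (A → ℚ) → ℚ
Σℚ-if xs c f = Σℚ (filterᵇ c xs) f

elems : {N : ℕ} → Subset N → List (Fin N)
elems {N} S = filterᵇ (λ i → lookup S i) (allFin N)

memᵇ : {N : ℕ} → Fin N → List (Fin N) → Bool
memᵇ i xs = any (λ j → ⌊ i ≟ j ⌋) xs

-- Set partitions of a (duplicate-free) list: each partition is a list of
-- blocks, each block a nonempty list.  Every set partition of the
-- underlying set occurs exactly once (standard recursive enumeration: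
-- the first element either forms a new singleton block or is inserted
-- into one of the blocks of a partition of the rest).

insertEach : {A : Set} → A → List (List A) → List (List (List A))
insertEach x [] = []
insertEach x (b ∷ bs) = ((x ∷ b) ∷ bs) ∷ map (b ∷_) (insertEach x bs)

partitions : {A : Set} → List A → List (List (List A))
partitions [] = [ [] ]
partitions (x ∷ xs) = concatMap (λ π → ([ x ] ∷ π) ∷ insertEach x π) (partitions xs)

Partitions : {N : ℕ} → Subset N → List (List (List (Fin N)))
Partitions W = partitions (elems W)

-- Hypergraph Γ = (Ω, X) with Ω = Fin m and edges γ₁ … γ_N given by
-- γ : Fin N → Subset m;  probabilities p : Fin m → ℚ.

module Hypergraph {m N : ℕ} (γ : Fin N → Subset m) (p : Fin m → ℚ) where

  adj : Fin N → Fin N → Bool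
  adj i j = not ⌊ i ≟ j ⌋ ∧ any (λ ω → lookup (γ i) ω ∧ lookup (γ j) ω) (allFin m)

  -- E[X_P] = ∏_{ω ∈ ⋃_{i∈P} γ_i} p_ω   (X_P = ∏_{i∈P} X_i, independence)
  EX : List (Fin N) → ℚ
  EX P = Πℚ (allFin m) (λ ω → if any (λ i → lookup (γ i) ω) P then p ω else 1ℚ)

  μ : List (List (Fin N)) → ℚ
  μ π = Πℚ π EX

  ⊆blockᵇ : Subset N → List (Fin N) → Bool
  ⊆blockᵇ V P = all (λ i → memᵇ i P) (elems V)

  ≡blockᵇ : Subset N → List (Fin N) → Bool
  ≡blockᵇ V P = ⊆blockᵇ V P ∧ all (λ i → lookup V i) P

  -- V (⊆ P) is a union of connected components of G_Γ[P]:
  -- no edge of G_Γ joins a vertex of V to a vertex of P ∖ V.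
  unionOfComponentsᵇ : Subset N → List (Fin N) → Bool
  unionOfComponentsᵇ V P =
    all (λ i → all (λ j → lookup V j ∨ not (adj i j)) P) (elems V)

  inΠCᵇ : Subset N → List (List (Fin N)) → Bool
  inΠCᵇ V π = any (λ P → ⊆blockᵇ V P ∧ unionOfComponentsᵇ V P) π

  inΠᵇ : Subset N → List (List (Fin N)) → Bool
  inΠᵇ V π = any (≡blockᵇ V) π

  edgeBetweenᵇ : List (Fin N) → List (Fin N) → Bool
  edgeBetweenᵇ A B = any (λ i → any (λ j → adj i j) B) A

  degree : Subset N → List (List (Fin N)) → ℕ
  degree V π = length (filterᵇ (λ P' → not (≡blockᵇ V P') ∧ edgeBetweenᵇ P' (elems V)) π)

  χ : Subset N → List (List (Fin N)) → ℚ
  χ V π with length π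
  ... | zero = ℕ→ℚ 0
  ... | suc zero = 1ℚ
  ... | suc (suc k) = ℕ→ℚ (degree V π) * ℕ→ℚ (k !)

  κ : Subset N → Subset N → ℚ
  κ V W = Σℚ-if (Partitions W) (inΠCᵇ V)
            (λ π → sgn (pred (length π)) * ℕ→ℚ ((pred (length π)) !) * μ π)

  rhs : Subset N → Subset N → ℚ
  rhs V W = Σℚ-if (Partitions W) (inΠᵇ V)
              (λ π → sgn (pred (length π)) * χ V π * μ π)

{-# OPTIONS --safe #-}
-- Fix v ∈ V.  Both sums only see, in a partition π of W, the block containing v, so each is
-- reorganised over splits W = S ⊎ D, the block S together with a partition ρ of D.  On the
-- κ side S must contain V as a union of components of G_Γ[S]: then S ∖ V is not adjacent to V,
-- E[X_S] = E[X_V] E[X_(S∖V)], and ρ contributes Φ(D) = Σ_ρ (-1)^|ρ| |ρ|! μ_ρ.  So κ_V(W) is a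
-- sum over splits W = R ⊎ R' ⊎ D' with R = V and R' not adjacent to V, of E[X_R] E[X_R'] Φ(D').
-- On the right-hand side the block is V itself, and d_π(V) = |ρ| − #{blocks of ρ not adjacent
-- to V} rewrites the term of π = V ∷ ρ as a sum over ρ with one marked, possibly empty, block
-- not adjacent to V; regrouping by the marked block R' gives the same triple sum.
module Submission where

open import Defs
open import Data.Nat.Base using (ℕ)
open import Data.Fin.Base using (Fin)
open import Data.Fin.Subset using (Subset; _⊆_; Nonempty)
open import Data.Rational.Base using (ℚ; _<_; 0ℚ; 1ℚ)
open import Data.Product using (_×_)
open import Function.Definitions using (Injective)
open import Relation.Binary.PropositionalEquality using (_≡_)

open import Data.Bool.Base using (Bool; true; false; T; _∧_; _∨_; not; if_then_else_)
open import Data.Bool.ListAction using (any; all)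
open import Data.Bool.Properties using (∧-zeroʳ; ∧-comm; ∨-zeroʳ; T-∧; T-≡)
open import Data.Empty using (⊥-elim)
open import Data.Fin.Properties using (_≟_)
import Data.Integer.Base as ℤ
import Data.Integer.Properties as ℤ
open import Data.List.Base
  using (List; []; _∷_; [_]; _++_; map; concat; concatMap; filter; filterᵇ; length; allFin)
open import Data.List.Membership.Propositional using (_∈_; _∉_; find; lose)
open import Data.List.Membership.Propositional.Properties
  using (∈-length; ∈-filter⁺; ∈-filter⁻; ∈-++⁻; ∈-++⁺ˡ; ∈-allFin)
open import Data.List.Properties using (filter-++; filter-none; length-++)
open import Data.List.Relation.Binary.Permutation.Propositional
  using (_↭_; refl; prep; swap; trans; ↭-sym)
open import Data.List.Relation.Binary.Permutation.Propositional.Properties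
  using (shift; ++⁺ˡ; ↭-length; filter-↭; ∈-resp-↭)
open import Data.List.Relation.Unary.All as All using (All; []; _∷_)
import Data.List.Relation.Unary.All.Properties as All
open import Data.List.Relation.Unary.All.Properties using (all⁺; all⁻)
import Data.List.Relation.Unary.Any as Any
open import Data.List.Relation.Unary.Any.Properties using (any⁺; any⁻)
open import Data.List.Relation.Unary.AllPairs using ([]; _∷_)
open import Data.List.Relation.Unary.Unique.Propositional using (Unique)
import Data.List.Relation.Unary.Unique.Propositional.Properties as Unique
open import Data.Nat.Base as ℕ using (zero; suc; _!; pred)
import Data.Nat.Coprimality as Coprimality
import Data.Nat.Properties as ℕ
open import Data.Product using (_,_; proj₁; proj₂; uncurry; map₁; map₂; ∃; ∃₂)
open import Data.Rational.Base using (_+_; _*_; -_; mkℚ)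
open import Data.Rational.Properties
  using (+-identityˡ; +-identityʳ; +-assoc; *-identityˡ; *-identityʳ; *-assoc; *-zeroˡ; *-zeroʳ;
         *-comm; *-distribˡ-+; *-distribʳ-+; normalize-coprime; /-cong)
open import Data.Rational.Solver using (module +-*-Solver)
open import Data.Sum.Base using (inj₁; inj₂)
open import Data.Unit.Base using (tt)
open import Data.Vec.Base using (lookup)
open import Data.Vec.Properties using ([]=⇒lookup)
open import Function.Base using (_∘_)
open import Function.Bundles using (module Equivalence)
open import Relation.Binary.Core using (_Preserves_⟶_)
open import Relation.Binary.Definitions using (DecidableEquality)
open import Relation.Binary.PropositionalEquality
  using (_≢_; refl; sym; cong; cong₂; subst; module ≡-Reasoning)
  renaming (trans to ≡-trans)
open import Relation.Nullary.Decidable using (yes; no; T?; ⌊_⌋; toWitness; fromWitness)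
open import Relation.Nullary.Negation.Core using (¬_)

open Equivalence using (to; from)
open +-*-Solver

ℕ→ℚ-mkℚ : ∀ n → ℕ→ℚ n ≡ mkℚ (ℤ.+ n) 0 (Coprimality.sym (Coprimality.1-coprimeTo n))
ℕ→ℚ-mkℚ n = normalize-coprime _

ℕ→ℚ-+ : ∀ a b → ℕ→ℚ (a ℕ.+ b) ≡ ℕ→ℚ a + ℕ→ℚ b
ℕ→ℚ-+ a b rewrite ℕ→ℚ-mkℚ a | ℕ→ℚ-mkℚ b =
  /-cong {p₁ = ℤ.+ (a ℕ.+ b)}
         (cong₂ ℤ._+_ (sym (ℤ.*-identityʳ (ℤ.+ a))) (sym (ℤ.*-identityʳ (ℤ.+ b)))) refl

ℕ→ℚ-* : ∀ a b → ℕ→ℚ (a ℕ.* b) ≡ ℕ→ℚ a * ℕ→ℚ b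
ℕ→ℚ-* a b rewrite ℕ→ℚ-mkℚ a | ℕ→ℚ-mkℚ b =
  /-cong {p₁ = ℤ.+ (a ℕ.* b)} {q₁ = 1} {p₂ = ℤ.+ a ℤ.* ℤ.+ b} {q₂ = 1} (ℤ.pos-* a b) refl

𝟙 : Bool → ℚ
𝟙 true  = 1ℚ
𝟙 false = 0ℚ

count : {A : Set} → (A → Bool) → List A → ℕ
count c xs = length (filterᵇ c xs)

T-ext : ∀ {a b} → (T a → T b) → (T b → T a) → a ≡ b
T-ext {false} {false} _   _   = refl
T-ext {false} {true}  _   b⇒a = ⊥-elim (b⇒a tt)
T-ext {true}  {false} a⇒b _   = ⊥-elim (a⇒b tt)
T-ext {true}  {true}  _   _   = refl

T-not⁺ : ∀ {b} → ¬ T b → T (not b)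
T-not⁺ {false} _  = tt
T-not⁺ {true}  ¬b = ¬b tt

T-not⁻ : ∀ {b} → T (not b) → ¬ T b
T-not⁻ {false} _ ()

¬T⇒≡false : ∀ {b} → ¬ T b → b ≡ false
¬T⇒≡false ¬b = T-ext (⊥-elim ∘ ¬b) λ ()

T-stable : ∀ {b} → ¬ ¬ T b → T b
T-stable {false} ¬¬b = ⊥-elim (¬¬b λ ())
T-stable {true}  _   = tt

T-∨-not⁺ : ∀ {a b} → (T b → T a) → T (a ∨ not b)
T-∨-not⁺ {true}          _   = tt
T-∨-not⁺ {false} {false} _   = tt
T-∨-not⁺ {false} {true}  b⇒a = b⇒a tt

T-∨-not⁻ : ∀ {a b} → T (a ∨ not b) → T b → T a
T-∨-not⁻ {true}  _ _  = tt
T-∨-not⁻ {false} t tb = ⊥-elim (T-not⁻ t tb)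

𝟙-*-cong : ∀ b {x y} → (T b → x ≡ y) → 𝟙 b * x ≡ 𝟙 b * y
𝟙-*-cong true  x≡y = cong (1ℚ *_) (x≡y tt)
𝟙-*-cong false {x} {y} _ = ≡-trans (*-zeroˡ x) (sym (*-zeroˡ y))

module _ {A : Set} where

  count-reject : ∀ (c : A → Bool) {x} xs → c x ≡ false → count c (x ∷ xs) ≡ count c xs
  count-reject c xs cx rewrite cx = refl

  count-+-count-not : ∀ (c : A → Bool) xs → count c xs ℕ.+ count (not ∘ c) xs ≡ length xs
  count-+-count-not c []       = refl
  count-+-count-not c (x ∷ xs) with c x
  ... | true  = cong suc (count-+-count-not c xs)
  ... | false = ≡-trans (ℕ.+-suc _ _) (cong suc (count-+-count-not c xs))

  any-filter : ∀ (q c : A → Bool) xs → any q xs ≡ any q (filterᵇ c xs) ∨ any q (filterᵇ (not ∘ c) xs)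
  any-filter q c []       = refl
  any-filter q c (x ∷ xs) with c x
  ... | true  with q x
  ...   | true  = refl
  ...   | false = any-filter q c xs
  any-filter q c (x ∷ xs) | false with q x
  ...   | true  = sym (∨-zeroʳ _)
  ...   | false = any-filter q c xs

module _ {A : Set} where

  Σℚ-++ : ∀ xs ys (f : A → ℚ) → Σℚ (xs ++ ys) f ≡ Σℚ xs f + Σℚ ys f
  Σℚ-++ []       ys f = sym (+-identityˡ _)
  Σℚ-++ (x ∷ xs) ys f = ≡-trans (cong (f x +_) (Σℚ-++ xs ys f)) (sym (+-assoc (f x) _ _))

  Σℚ-map : {B : Set} (g : A → B) (xs : List A) (f : B → ℚ) → Σℚ (map g xs) f ≡ Σℚ xs (f ∘ g)
  Σℚ-map g []       f = refl
  Σℚ-map g (x ∷ xs) f = cong (f (g x) +_) (Σℚ-map g xs f)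

  Σℚ-concatMap : {B : Set} (g : B → List A) (xs : List B) (f : A → ℚ) →
    Σℚ (concatMap g xs) f ≡ Σℚ xs (λ x → Σℚ (g x) f)
  Σℚ-concatMap g []       f = refl
  Σℚ-concatMap g (x ∷ xs) f =
    ≡-trans (Σℚ-++ (g x) (concatMap g xs) f) (cong (Σℚ (g x) f +_) (Σℚ-concatMap g xs f))

  Σℚ-cong : ∀ xs {f g : A → ℚ} → (∀ x → f x ≡ g x) → Σℚ xs f ≡ Σℚ xs g
  Σℚ-cong []       f≗g = refl
  Σℚ-cong (x ∷ xs) f≗g = cong₂ _+_ (f≗g x) (Σℚ-cong xs f≗g)

  Σℚ-cong-All : ∀ {xs} {f g : A → ℚ} → All (λ x → f x ≡ g x) xs → Σℚ xs f ≡ Σℚ xs g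
  Σℚ-cong-All []           = refl
  Σℚ-cong-All (fx≡gx ∷ eq) = cong₂ _+_ fx≡gx (Σℚ-cong-All eq)

  Σℚ-zero : ∀ xs → Σℚ xs (λ (_ : A) → 0ℚ) ≡ 0ℚ
  Σℚ-zero []       = refl
  Σℚ-zero (x ∷ xs) = ≡-trans (+-identityˡ _) (Σℚ-zero xs)

  Σℚ-+ : ∀ xs (f g : A → ℚ) → Σℚ xs (λ x → f x + g x) ≡ Σℚ xs f + Σℚ xs g
  Σℚ-+ []       f g = refl
  Σℚ-+ (x ∷ xs) f g = ≡-trans (cong (f x + g x +_) (Σℚ-+ xs f g))
    (solve 4 (λ a b c d → (a :+ b) :+ (c :+ d) := (a :+ c) :+ (b :+ d)) refl
       (f x) (g x) (Σℚ xs f) (Σℚ xs g))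

  Σℚ-*ˡ : ∀ c xs (f : A → ℚ) → c * Σℚ xs f ≡ Σℚ xs (λ x → c * f x)
  Σℚ-*ˡ c []       f = *-zeroʳ c
  Σℚ-*ˡ c (x ∷ xs) f = ≡-trans (*-distribˡ-+ c (f x) _) (cong (c * f x +_) (Σℚ-*ˡ c xs f))

  Σℚ-*ʳ : ∀ c xs (f : A → ℚ) → Σℚ xs f * c ≡ Σℚ xs (λ x → f x * c)
  Σℚ-*ʳ c xs f = ≡-trans (*-comm _ c) (≡-trans (Σℚ-*ˡ c xs f) (Σℚ-cong xs (λ x → *-comm c (f x))))

  Σℚ-if-𝟙 : ∀ xs (c : A → Bool) f → Σℚ-if xs c f ≡ Σℚ xs (λ x → 𝟙 (c x) * f x)
  Σℚ-if-𝟙 []       c f = refl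
  Σℚ-if-𝟙 (x ∷ xs) c f with c x
  ... | true  = cong₂ _+_ (sym (*-identityˡ (f x))) (Σℚ-if-𝟙 xs c f)
  ... | false = ≡-trans (Σℚ-if-𝟙 xs c f) (sym (≡-trans (cong (_+ _) (*-zeroˡ (f x))) (+-identityˡ _)))

  Σℚ-𝟙 : ∀ (c : A → Bool) xs → Σℚ xs (𝟙 ∘ c) ≡ ℕ→ℚ (count c xs)
  Σℚ-𝟙 c []       = refl
  Σℚ-𝟙 c (x ∷ xs) with c x
  ... | true  = ≡-trans (cong (1ℚ +_) (Σℚ-𝟙 c xs)) (sym (ℕ→ℚ-+ 1 (count c xs)))
  ... | false = ≡-trans (+-identityˡ _) (Σℚ-𝟙 c xs)

  𝟙-any : ∀ (c : A → Bool) xs → count c xs ℕ.≤ 1 → 𝟙 (any c xs) ≡ Σℚ xs (𝟙 ∘ c)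
  𝟙-any c []       _ = refl
  𝟙-any c (x ∷ xs) n≤1 with c x
  ... | false = ≡-trans (𝟙-any c xs n≤1) (sym (+-identityˡ _))
  ... | true  = sym (≡-trans (cong (1ℚ +_) (Σℚ-𝟙 c xs)) (cong (λ n → 1ℚ + ℕ→ℚ n) none))
    where none : count c xs ≡ 0
          none = ℕ.n≤0⇒n≡0 (ℕ.≤-pred n≤1)

  Πℚ-cong : ∀ xs {f g : A → ℚ} → (∀ x → f x ≡ g x) → Πℚ xs f ≡ Πℚ xs g
  Πℚ-cong []       f≗g = refl
  Πℚ-cong (x ∷ xs) f≗g = cong₂ _*_ (f≗g x) (Πℚ-cong xs f≗g)

  Πℚ-* : ∀ xs (f g : A → ℚ) → Πℚ xs f * Πℚ xs g ≡ Πℚ xs (λ x → f x * g x)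
  Πℚ-* []       f g = refl
  Πℚ-* (x ∷ xs) f g = ≡-trans
    (solve 4 (λ a b c d → (a :* c) :* (b :* d) := (a :* b) :* (c :* d)) refl
       (f x) (g x) (Πℚ xs f) (Πℚ xs g))
    (cong (f x * g x *_) (Πℚ-* xs f g))

  Πℚ-one : ∀ xs → Πℚ xs (λ (_ : A) → 1ℚ) ≡ 1ℚ
  Πℚ-one []       = refl
  Πℚ-one (x ∷ xs) = ≡-trans (*-identityˡ _) (Πℚ-one xs)

  Πℚ-↭ : (f : A → ℚ) → (λ xs → Πℚ xs f) Preserves _↭_ ⟶ _≡_
  Πℚ-↭ f refl          = refl
  Πℚ-↭ f (prep x p)    = cong (f x *_) (Πℚ-↭ f p)
  Πℚ-↭ f (swap x y p)  = ≡-trans (cong (λ P → f x * (f y * P)) (Πℚ-↭ f p))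
    (solve 3 (λ a b c → a :* (b :* c) := b :* (a :* c)) refl (f x) (f y) _)
  Πℚ-↭ f (trans p q)   = ≡-trans (Πℚ-↭ f p) (Πℚ-↭ f q)

module _ {A : Set} where

  picks : List A → List (A × List A)
  picks []       = []
  picks (b ∷ bs) = (b , bs) ∷ map (map₂ (b ∷_)) (picks bs)

  Σpicks : List A → (A → List A → ℚ) → ℚ
  Σpicks π G = Σℚ (picks π) (uncurry G)

  Σpicks-∷ : ∀ b bs (G : A → List A → ℚ) →
    Σpicks (b ∷ bs) G ≡ G b bs + Σpicks bs (λ B r → G B (b ∷ r))
  Σpicks-∷ b bs G = cong (G b bs +_) (Σℚ-map (map₂ (b ∷_)) (picks bs) (uncurry G))

  Σpicks-cong : ∀ π {G H : A → List A → ℚ} → (∀ B r → G B r ≡ H B r) →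
    Σpicks π G ≡ Σpicks π H
  Σpicks-cong π G≗H = Σℚ-cong (picks π) (λ (B , r) → G≗H B r)

  Σpicks-+ : ∀ π (G H : A → List A → ℚ) →
    Σpicks π (λ B r → G B r + H B r) ≡ Σpicks π G + Σpicks π H
  Σpicks-+ π G H = Σℚ-+ (picks π) (uncurry G) (uncurry H)

  Σpicks-↭ : ∀ (g : A → ℚ) {H : List A → ℚ} → H Preserves _↭_ ⟶ _≡_ → ∀ π →
    Σpicks π (λ B r → g B * H (B ∷ r)) ≡ Σℚ π g * H π
  Σpicks-↭ g {H} H-↭ []       = sym (*-zeroˡ (H []))
  Σpicks-↭ g {H} H-↭ (b ∷ bs) = begin
    Σpicks (b ∷ bs) (λ B r → g B * H (B ∷ r))
      ≡⟨ Σpicks-∷ b bs (λ B r → g B * H (B ∷ r)) ⟩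
    g b * H (b ∷ bs) + Σpicks bs (λ B r → g B * H (B ∷ b ∷ r))
      ≡⟨ cong (g b * H (b ∷ bs) +_) (Σpicks-cong bs (λ B r → cong (g B *_) (H-↭ (swap B b refl)))) ⟩
    g b * H (b ∷ bs) + Σpicks bs (λ B r → g B * H (b ∷ B ∷ r))
      ≡⟨ cong (g b * H (b ∷ bs) +_) (Σpicks-↭ g (H-↭ ∘ prep b) bs) ⟩
    g b * H (b ∷ bs) + Σℚ bs g * H (b ∷ bs)
      ≡⟨ *-distribʳ-+ (H (b ∷ bs)) (g b) (Σℚ bs g) ⟨
    Σℚ (b ∷ bs) g * H (b ∷ bs) ∎
    where open ≡-Reasoning

  splits : List A → List (List A × List A)
  splits []       = [ ([] , []) ]
  splits (x ∷ xs) = map (map₁ (x ∷_)) (splits xs) ++ map (map₂ (x ∷_)) (splits xs)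

  Σsplits : List A → (List A → List A → ℚ) → ℚ
  Σsplits U f = Σℚ (splits U) (uncurry f)

  Σsplits-∷ : ∀ x xs (f : List A → List A → ℚ) →
    Σsplits (x ∷ xs) f ≡ Σsplits xs (λ R D → f (x ∷ R) D) + Σsplits xs (λ R D → f R (x ∷ D))
  Σsplits-∷ x xs f = ≡-trans (Σℚ-++ (map (map₁ (x ∷_)) (splits xs)) _ (uncurry f))
    (cong₂ _+_ (Σℚ-map (map₁ (x ∷_)) (splits xs) (uncurry f))
               (Σℚ-map (map₂ (x ∷_)) (splits xs) (uncurry f)))

  Σsplits-cong : ∀ U {f g : List A → List A → ℚ} → (∀ R D → f R D ≡ g R D) →
    Σsplits U f ≡ Σsplits U g
  Σsplits-cong U f≗g = Σℚ-cong (splits U) (λ (R , D) → f≗g R D)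

  Σsplits-+ : ∀ U (f g : List A → List A → ℚ) →
    Σsplits U (λ R D → f R D + g R D) ≡ Σsplits U f + Σsplits U g
  Σsplits-+ U f g = Σℚ-+ (splits U) (uncurry f) (uncurry g)

  Σsplits-assoc : ∀ U (K : List A → List A → List A → ℚ) →
    Σsplits U (λ R D → Σsplits D (K R)) ≡ Σsplits U (λ S D → Σsplits S (λ R R' → K R R' D))
  Σsplits-assoc []       K = refl
  Σsplits-assoc (x ∷ xs) K = begin
    Σsplits (x ∷ xs) (λ R D → Σsplits D (K R))
      ≡⟨ Σsplits-∷ x xs (λ R D → Σsplits D (K R)) ⟩
    left K₁ + Σsplits xs (λ R D → Σsplits (x ∷ D) (K R))
      ≡⟨ cong (left K₁ +_) (≡-trans (Σsplits-cong xs (λ R D → Σsplits-∷ x D (K R)))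
                                    (Σsplits-+ xs (λ R D → Σsplits D (K₂ R)) (λ R D → Σsplits D (K₃ R)))) ⟩
    left K₁ + (left K₂ + left K₃)
      ≡⟨ cong₂ _+_ (Σsplits-assoc xs K₁) (cong₂ _+_ (Σsplits-assoc xs K₂) (Σsplits-assoc xs K₃)) ⟩
    right K₁ + (right K₂ + right K₃)
      ≡⟨ +-assoc (right K₁) (right K₂) (right K₃) ⟨
    (right K₁ + right K₂) + right K₃
      ≡⟨ cong (_+ right K₃) (≡-trans
           (Σsplits-cong xs (λ S D → Σsplits-∷ x S (λ R R' → K R R' D)))
           (Σsplits-+ xs (λ S D → Σsplits S (λ R R' → K₁ R R' D))
                         (λ S D → Σsplits S (λ R R' → K₂ R R' D)))) ⟨
    Σsplits xs (λ S D → Σsplits (x ∷ S) (λ R R' → K R R' D)) + right K₃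
      ≡⟨ Σsplits-∷ x xs (λ S D → Σsplits S (λ R R' → K R R' D)) ⟨
    Σsplits (x ∷ xs) (λ S D → Σsplits S (λ R R' → K R R' D)) ∎
    where
      open ≡-Reasoning
      K₁ K₂ K₃ : List A → List A → List A → ℚ
      K₁ R R' D = K (x ∷ R) R' D
      K₂ R R' D = K R (x ∷ R') D
      K₃ R R' D = K R R' (x ∷ D)
      left right : (List A → List A → List A → ℚ) → ℚ
      left  K′ = Σsplits xs (λ R D → Σsplits D (K′ R))
      right K′ = Σsplits xs (λ S D → Σsplits S (λ R R' → K′ R R' D))

  Σsplits-filter : ∀ (c : A → Bool) S (h : List A → List A → ℚ) →
    Σsplits S (λ R R' → 𝟙 (all c R ∧ all (not ∘ c) R') * h R R') ≡
    h (filterᵇ c S) (filterᵇ (not ∘ c) S)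
  Σsplits-filter c []       h = ≡-trans (+-identityʳ _) (*-identityˡ _)
  Σsplits-filter c (x ∷ xs) h
    rewrite Σsplits-∷ x xs (λ R R' → 𝟙 (all c R ∧ all (not ∘ c) R') * h R R')
    with c x
  ... | true  = ≡-trans
    (cong₂ _+_ (Σsplits-filter c xs (λ R R' → h (x ∷ R) R'))
               (≡-trans (Σsplits-cong xs excluded) (Σℚ-zero (splits xs))))
    (+-identityʳ _)
    where
      excluded : ∀ R R' → 𝟙 (all c R ∧ false) * h R (x ∷ R') ≡ 0ℚ
      excluded R R' =
        ≡-trans (cong (λ b → 𝟙 b * h R (x ∷ R')) (∧-zeroʳ (all c R))) (*-zeroˡ (h R (x ∷ R')))
  ... | false = ≡-trans
    (cong₂ _+_ (≡-trans (Σsplits-cong xs (λ R R' → *-zeroˡ (h (x ∷ R) R'))) (Σℚ-zero (splits xs)))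
               (Σsplits-filter c xs (λ R R' → h R (x ∷ R'))))
    (+-identityˡ _)

module _ {A : Set} where

  Σmarked : (List A → List (List A) → ℚ) → List (List A) → ℚ
  Σmarked G π = G [] π + Σpicks π G

  extensions : A → List (List A) → List (List (List A))
  extensions x π = ([ x ] ∷ π) ∷ insertEach x π

  Σℚ-partitions-∷ : ∀ x xs (f : List (List A) → ℚ) →
    Σℚ (partitions (x ∷ xs)) f ≡ Σℚ (partitions xs) (λ π → Σℚ (extensions x π) f)
  Σℚ-partitions-∷ x xs f = Σℚ-concatMap (extensions x) (partitions xs) f

  -- x goes either into the marked block or into one of the others.
  Σℚ-insertEach-Σpicks : ∀ x π (G : List A → List (List A) → ℚ) →
    Σℚ (insertEach x π) (λ σ → Σpicks σ G) ≡
    Σpicks π (λ B r → G (x ∷ B) r + Σℚ (insertEach x r) (G B))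
  Σℚ-insertEach-Σpicks x []       G = refl
  Σℚ-insertEach-Σpicks x (b ∷ bs) G = begin
    Σpicks ((x ∷ b) ∷ bs) G + Σℚ (map (b ∷_) (insertEach x bs)) (λ σ → Σpicks σ G)
      ≡⟨ cong₂ _+_ (Σpicks-∷ (x ∷ b) bs G) (Σℚ-map (b ∷_) (insertEach x bs) (λ σ → Σpicks σ G)) ⟩
    (G (x ∷ b) bs + P₁) + Σℚ (insertEach x bs) (λ σ → Σpicks (b ∷ σ) G)
      ≡⟨ cong ((G (x ∷ b) bs + P₁) +_) (≡-trans (Σℚ-cong (insertEach x bs) (λ σ → Σpicks-∷ b σ G))
                                                (Σℚ-+ (insertEach x bs) (G b) (λ σ → Σpicks σ G′))) ⟩
    (G (x ∷ b) bs + P₁) + (Σℚ (insertEach x bs) (G b) + Σℚ (insertEach x bs) (λ σ → Σpicks σ G′))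
      ≡⟨ cong (λ P → (G (x ∷ b) bs + P₁) + (Σℚ (insertEach x bs) (G b) + P))
              (Σℚ-insertEach-Σpicks x bs G′) ⟩
    (G (x ∷ b) bs + P₁) + (Σℚ (insertEach x bs) (G b) + P₂)
      ≡⟨ solve 4 (λ a p c q → (a :+ p) :+ (c :+ q) := (a :+ c) :+ (p :+ q)) refl
           (G (x ∷ b) bs) P₁ (Σℚ (insertEach x bs) (G b)) P₂ ⟩
    (G (x ∷ b) bs + Σℚ (insertEach x bs) (G b)) + (P₁ + P₂)
      ≡⟨ cong ((G (x ∷ b) bs + Σℚ (insertEach x bs) (G b)) +_)
              (≡-trans (sym (Σpicks-+ bs (λ B r → G B ((x ∷ b) ∷ r))
                                         (λ B r → G′ (x ∷ B) r + Σℚ (insertEach x r) (G′ B))))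
                       (Σpicks-cong bs regroup)) ⟩
    (G (x ∷ b) bs + Σℚ (insertEach x bs) (G b)) + Σpicks bs (λ B r → Gₓ B (b ∷ r))
      ≡⟨ Σpicks-∷ b bs Gₓ ⟨
    Σpicks (b ∷ bs) Gₓ ∎
    where
      open ≡-Reasoning
      G′ Gₓ : List A → List (List A) → ℚ
      G′ B r = G B (b ∷ r)
      Gₓ B r = G (x ∷ B) r + Σℚ (insertEach x r) (G B)
      P₁ P₂ : ℚ
      P₁ = Σpicks bs (λ B r → G B ((x ∷ b) ∷ r))
      P₂ = Σpicks bs (λ B r → G′ (x ∷ B) r + Σℚ (insertEach x r) (G′ B))
      regroup : ∀ B r →
        G B ((x ∷ b) ∷ r) + (G′ (x ∷ B) r + Σℚ (insertEach x r) (G′ B)) ≡ Gₓ B (b ∷ r)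
      regroup B r = ≡-trans
        (solve 3 (λ a c d → a :+ (c :+ d) := c :+ (a :+ d)) refl
          (G B ((x ∷ b) ∷ r)) (G′ (x ∷ B) r) (Σℚ (insertEach x r) (G′ B)))
        (cong (λ S → G (x ∷ B) (b ∷ r) + (G B ((x ∷ b) ∷ r) + S))
              (sym (Σℚ-map (b ∷_) (insertEach x r) (G B))))

  Σmarked-extensions : ∀ x π (G : List A → List (List A) → ℚ) →
    Σℚ (extensions x π) (Σmarked G) ≡
    Σmarked (G ∘ (x ∷_)) π + Σmarked (λ B r → Σℚ (extensions x r) (G B)) π
  Σmarked-extensions x π G = begin
    Σmarked G ([ x ] ∷ π) + Σℚ (insertEach x π) (Σmarked G)
      ≡⟨ cong₂ _+_ (cong (a +_) (Σpicks-∷ [ x ] π G))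
                   (Σℚ-+ (insertEach x π) (G []) (λ σ → Σpicks σ G)) ⟩
    (a + (b + c)) + (d + Σℚ (insertEach x π) (λ σ → Σpicks σ G))
      ≡⟨ cong (λ P → (a + (b + c)) + (d + P))
              (≡-trans (Σℚ-insertEach-Σpicks x π G)
                       (Σpicks-+ π (G ∘ (x ∷_)) (λ B r → Σℚ (insertEach x r) (G B)))) ⟩
    (a + (b + c)) + (d + (e + f))
      ≡⟨ solve 6 (λ a b c d e f → (a :+ (b :+ c)) :+ (d :+ (e :+ f)) := (b :+ e) :+ ((a :+ d) :+ (c :+ f)))
           refl a b c d e f ⟩
    (b + e) + ((a + d) + (c + f))
      ≡⟨ cong (λ P → (b + e) + ((a + d) + P))
              (Σpicks-+ π (λ B r → G B ([ x ] ∷ r)) (λ B r → Σℚ (insertEach x r) (G B))) ⟨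
    Σmarked (G ∘ (x ∷_)) π + Σmarked (λ B r → Σℚ (extensions x r) (G B)) π ∎
    where
      open ≡-Reasoning
      a b c d e f : ℚ
      a = G [] ([ x ] ∷ π)
      b = G [ x ] π
      c = Σpicks π (λ B r → G B ([ x ] ∷ r))
      d = Σℚ (insertEach x π) (G [])
      e = Σpicks π (G ∘ (x ∷_))
      f = Σpicks π (λ B r → Σℚ (insertEach x r) (G B))

  -- A partition of U with a marked block, possibly an extra empty one, is the same as a split
  -- (R , D) of U together with a partition of D.
  Σℚ-partitions-marked : ∀ U (G : List A → List (List A) → ℚ) →
    Σℚ (partitions U) (Σmarked G) ≡ Σsplits U (λ R D → Σℚ (partitions D) (G R))
  Σℚ-partitions-marked []       G = refl
  Σℚ-partitions-marked (x ∷ xs) G = begin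
    Σℚ (partitions (x ∷ xs)) (Σmarked G)
      ≡⟨ Σℚ-partitions-∷ x xs (Σmarked G) ⟩
    Σℚ (partitions xs) (λ π → Σℚ (extensions x π) (Σmarked G))
      ≡⟨ Σℚ-cong (partitions xs) (λ π → Σmarked-extensions x π G) ⟩
    Σℚ (partitions xs) (λ π → Σmarked G₁ π + Σmarked G₂ π)
      ≡⟨ Σℚ-+ (partitions xs) (Σmarked G₁) (Σmarked G₂) ⟩
    Σℚ (partitions xs) (Σmarked G₁) + Σℚ (partitions xs) (Σmarked G₂)
      ≡⟨ cong₂ _+_ (Σℚ-partitions-marked xs G₁) (Σℚ-partitions-marked xs G₂) ⟩
    Σsplits xs (λ R D → Σℚ (partitions D) (G₁ R)) + Σsplits xs (λ R D → Σℚ (partitions D) (G₂ R))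
      ≡⟨ cong (Σsplits xs (λ R D → Σℚ (partitions D) (G₁ R)) +_)
              (Σsplits-cong xs (λ R D → Σℚ-partitions-∷ x D (G R))) ⟨
    Σsplits xs (λ R D → Σℚ (partitions D) (G (x ∷ R))) +
    Σsplits xs (λ R D → Σℚ (partitions (x ∷ D)) (G R))
      ≡⟨ Σsplits-∷ x xs (λ R D → Σℚ (partitions D) (G R)) ⟨
    Σsplits (x ∷ xs) (λ R D → Σℚ (partitions D) (G R)) ∎
    where
      open ≡-Reasoning
      G₁ G₂ : List A → List (List A) → ℚ
      G₁ = G ∘ (x ∷_)
      G₂ B r = Σℚ (extensions x r) (G B)

module _ {A : Set} where

  splits-↭ : ∀ (U : List A) → All (λ (R , D) → R ++ D ↭ U) (splits U)
  splits-↭ []       = refl ∷ []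
  splits-↭ (x ∷ xs) = All.++⁺
    (All.map⁺ (All.map (prep x) (splits-↭ xs)))
    (All.map⁺ (All.map (λ {(R , D)} R++D↭xs → trans (shift x R D) (prep x R++D↭xs)) (splits-↭ xs)))

  Σsplits-cong-↭ : ∀ U {f g : List A → List A → ℚ} → (∀ R D → R ++ D ↭ U → f R D ≡ g R D) →
    Σsplits U f ≡ Σsplits U g
  Σsplits-cong-↭ U f≗g = Σℚ-cong-All (All.map (λ {q} → f≗g (proj₁ q) (proj₂ q)) (splits-↭ U))

  insertEach-↭ : ∀ (x : A) π → All (λ σ → concat σ ↭ x ∷ concat π) (insertEach x π)
  insertEach-↭ x []       = []
  insertEach-↭ x (b ∷ bs) = refl ∷ All.map⁺
    (All.map (λ σ↭ → trans (++⁺ˡ b σ↭) (shift x b (concat bs))) (insertEach-↭ x bs))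

  partitions-↭ : ∀ (U : List A) → All (λ π → concat π ↭ U) (partitions U)
  partitions-↭ []       = refl ∷ []
  partitions-↭ (x ∷ xs) = All.concat⁺ (All.map⁺ (All.map
    (λ {π} π↭xs → prep x π↭xs ∷ All.map (λ σ↭ → trans σ↭ (prep x π↭xs)) (insertEach-↭ x π))
    (partitions-↭ xs)))

  split-⊇ : ∀ {R R' S : List A} {P : A → Set} → R ++ R' ↭ S → (∀ {i} → P i → i ∈ S) →
    All (¬_ ∘ P) R' → ∀ {i} → P i → i ∈ R
  split-⊇ {R} R++R'↭S P⊆S R'∩P≡∅ Pi with ∈-++⁻ R (∈-resp-↭ (↭-sym R++R'↭S) (P⊆S Pi))
  ... | inj₁ i∈R  = i∈R
  ... | inj₂ i∈R' = ⊥-elim (All.lookup R'∩P≡∅ i∈R' Pi)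

module Occurrences {A : Set} (_≟_ : DecidableEquality A) where

  occ : A → List A → ℕ
  occ y xs = length (filter (y ≟_) xs)

  occ-↭ : ∀ y → occ y Preserves _↭_ ⟶ _≡_
  occ-↭ y xs↭ys = ↭-length (filter-↭ (y ≟_) xs↭ys)

  occ-++ : ∀ y xs ys → occ y (xs ++ ys) ≡ occ y xs ℕ.+ occ y ys
  occ-++ y xs ys = ≡-trans (cong length (filter-++ (y ≟_) xs ys)) (length-++ (filter (y ≟_) xs))

  ∈⇒occ>0 : ∀ {y xs} → y ∈ xs → 0 ℕ.< occ y xs
  ∈⇒occ>0 y∈xs = ∈-length (∈-filter⁺ (_ ≟_) y∈xs refl)

  Unique⇒occ≤1 : ∀ {xs} → Unique xs → ∀ y → occ y xs ℕ.≤ 1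
  Unique⇒occ≤1 {[]}     []           y = ℕ.z≤n
  Unique⇒occ≤1 {x ∷ xs} (x∉xs ∷ !xs) y with y ≟ x
  ... | yes refl = ℕ.s≤s (ℕ.≤-reflexive (cong length (filter-none (y ≟_) x∉xs)))
  ... | no  _    = Unique⇒occ≤1 !xs y

  occ-split : ∀ {R D U} → R ++ D ↭ U → ∀ y → occ y R ℕ.≤ occ y U
  occ-split {R} {D} R++D↭U y = ℕ.≤-trans (ℕ.m≤m+n (occ y R) (occ y D))
    (ℕ.≤-reflexive (≡-trans (sym (occ-++ y R D)) (occ-↭ y R++D↭U)))

  split-∉ : ∀ {R R' S} → (∀ y → occ y S ℕ.≤ 1) → R ++ R' ↭ S → ∀ {y} → y ∈ R → y ∉ R'
  split-∉ {R} {R'} S! R++R'↭S {y} y∈R y∈R'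
    with ℕ.≤-trans (ℕ.+-mono-≤ (∈⇒occ>0 y∈R) (∈⇒occ>0 y∈R'))
                   (ℕ.≤-trans (ℕ.≤-reflexive (≡-trans (sym (occ-++ y R R')) (occ-↭ y R++R'↭S))) (S! y))
  ... | ℕ.s≤s ()

  count≤occ-concat : ∀ (c : List A → Bool) v → (∀ B → T (c B) → v ∈ B) → ∀ π →
    count c π ℕ.≤ occ v (concat π)
  count≤occ-concat c v c⇒∋v []      = ℕ.z≤n
  count≤occ-concat c v c⇒∋v (B ∷ π) with c B in cB
  ... | true  = ℕ.≤-trans (ℕ.+-mono-≤ (∈⇒occ>0 (c⇒∋v B (from T-≡ cB))) (count≤occ-concat c v c⇒∋v π))
                          (ℕ.≤-reflexive (sym (occ-++ v B (concat π))))
  ... | false = ℕ.≤-trans (count≤occ-concat c v c⇒∋v π)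
                          (ℕ.≤-trans (ℕ.m≤n+m _ (occ v B))
                                     (ℕ.≤-reflexive (sym (occ-++ v B (concat π)))))

  -- At most one block satisfies c, since each such block contains v and v occurs once in U.
  Σℚ-partitions-rooted : ∀ {U} → Unique U → ∀ v (c : List A → Bool) → (∀ B → T (c B) → v ∈ B) →
    (H : List (List A) → ℚ) → H Preserves _↭_ ⟶ _≡_ →
    Σℚ (partitions U) (λ π → 𝟙 (any c π) * H π) ≡
    Σsplits U (λ R D → Σℚ (partitions D) (λ ρ → 𝟙 (c R) * H (R ∷ ρ)))
  Σℚ-partitions-rooted {U} !U v c c⇒∋v H H-↭ = begin
    Σℚ (partitions U) (λ π → 𝟙 (any c π) * H π)
      ≡⟨ Σℚ-cong-All (All.map (λ {π} π↭U → cong (_* H π) (𝟙-any c π (atMostOne π π↭U)))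
                              (partitions-↭ U)) ⟩
    Σℚ (partitions U) (λ π → Σℚ π (𝟙 ∘ c) * H π)
      ≡⟨ Σℚ-cong (partitions U) (Σpicks-↭ (𝟙 ∘ c) H-↭) ⟨
    Σℚ (partitions U) (λ π → Σpicks π G)
      ≡⟨ Σℚ-cong (partitions U) (λ π → ≡-trans (cong (_+ Σpicks π G) (emptyRoot π))
                                               (+-identityˡ (Σpicks π G))) ⟨
    Σℚ (partitions U) (Σmarked G)
      ≡⟨ Σℚ-partitions-marked U G ⟩
    Σsplits U (λ R D → Σℚ (partitions D) (λ ρ → 𝟙 (c R) * H (R ∷ ρ))) ∎
    where
      open ≡-Reasoning
      G : List A → List (List A) → ℚ
      G B r = 𝟙 (c B) * H (B ∷ r)
      atMostOne : ∀ π → concat π ↭ U → count c π ℕ.≤ 1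
      atMostOne π π↭U = ℕ.≤-trans (count≤occ-concat c v c⇒∋v π)
        (ℕ.≤-trans (ℕ.≤-reflexive (occ-↭ v π↭U)) (Unique⇒occ≤1 !U v))
      emptyRoot : ∀ π → G [] π ≡ 0ℚ
      emptyRoot π with c [] in c[]
      ... | false = *-zeroˡ (H ([] ∷ π))
      ... | true  with () ← c⇒∋v [] (from T-≡ c[])

module _ {N : ℕ} where

  memᵇ⁺ : ∀ {i : Fin N} {xs} → i ∈ xs → T (memᵇ i xs)
  memᵇ⁺ i∈xs = any⁺ _ (Any.map fromWitness i∈xs)

  memᵇ⁻ : ∀ {i : Fin N} {xs} → T (memᵇ i xs) → i ∈ xs
  memᵇ⁻ {xs = xs} t = Any.map toWitness (any⁻ _ xs t)

  elems⁺ : ∀ {S : Subset N} {i} → T (lookup S i) → i ∈ elems S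
  elems⁺ {S} {i} = ∈-filter⁺ (T? ∘ lookup S) (∈-allFin i)

  elems⁻ : ∀ {S : Subset N} {i} → i ∈ elems S → T (lookup S i)
  elems⁻ {S} i∈S = proj₂ (∈-filter⁻ (T? ∘ lookup S) {xs = allFin N} i∈S)

  Unique-elems : (S : Subset N) → Unique (elems S)
  Unique-elems S = Unique.filter⁺ (T? ∘ lookup S) (Unique.allFin⁺ N)

module Rooted {m N : ℕ} (γ : Fin N → Subset m) (p : Fin m → ℚ) (V : Subset N)
                {v : Fin N} (v∈V : T (lookup V v)) where

  open Hypergraph γ p
  open Occurrences (_≟_ {N})

  InV : Fin N → Set
  InV i = T (lookup V i)

  adj⁺ : ∀ {i j ω} → i ≢ j → T (lookup (γ i) ω) → T (lookup (γ j) ω) → T (adj i j)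
  adj⁺ {ω = ω} i≢j iω jω =
    from T-∧ (T-not⁺ (i≢j ∘ toWitness) , any⁺ _ (lose (∈-allFin ω) (from T-∧ (iω , jω))))

  adj⁻ : ∀ {i j} → T (adj i j) → i ≢ j × ∃ λ ω → T (lookup (γ i) ω) × T (lookup (γ j) ω)
  adj⁻ {i} {j} t =
    let i≠j , shared = to (T-∧ {not ⌊ i ≟ j ⌋}) t
        ω , _ , iω∧jω = find (any⁻ _ (allFin m) shared)
    in T-not⁻ i≠j ∘ fromWitness , ω , to T-∧ iω∧jω

  adj-sym : ∀ {i j} → T (adj i j) → T (adj j i)
  adj-sym t with adj⁻ t
  ... | i≢j , ω , iω , jω = adj⁺ (i≢j ∘ sym) jω iω

  ⊆blockᵇ⁺ : ∀ {B} → (∀ {i} → InV i → i ∈ B) → T (⊆blockᵇ V B)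
  ⊆blockᵇ⁺ {B} V⊆B =
    all⁻ (λ i → memᵇ i B) (All.tabulate (λ i∈V → memᵇ⁺ (V⊆B (elems⁻ {S = V} i∈V))))

  ⊆blockᵇ⁻ : ∀ {B i} → T (⊆blockᵇ V B) → InV i → i ∈ B
  ⊆blockᵇ⁻ {B} V⊆B i∈V =
    memᵇ⁻ (All.lookup (all⁺ (λ i → memᵇ i B) (elems V) V⊆B) (elems⁺ {S = V} i∈V))

  unionOfComponentsᵇ⁺ : ∀ {S} → (∀ {i j} → InV i → j ∈ S → T (adj i j) → InV j) →
    T (unionOfComponentsᵇ V S)
  unionOfComponentsᵇ⁺ {S} closed = all⁻ (λ i → all (λ j → lookup V j ∨ not (adj i j)) S)
    (All.tabulate λ {i} i∈V → all⁻ (λ j → lookup V j ∨ not (adj i j))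
      (All.tabulate λ j∈S → T-∨-not⁺ (closed (elems⁻ {S = V} i∈V) j∈S)))

  unionOfComponentsᵇ⁻ : ∀ {S : List (Fin N)} {i j} → T (unionOfComponentsᵇ V S) →
    InV i → j ∈ S → T (adj i j) → InV j
  unionOfComponentsᵇ⁻ {S} {i} closed i∈V j∈S =
    T-∨-not⁻ (All.lookup (all⁺ (λ j → lookup V j ∨ not (adj i j)) S
      (All.lookup (all⁺ (λ i → all (λ j → lookup V j ∨ not (adj i j)) S) (elems V) closed)
                  (elems⁺ {S = V} i∈V))) j∈S)

  edgeBetweenᵇ⁺ : ∀ {A B i j} → i ∈ A → j ∈ B → T (adj i j) → T (edgeBetweenᵇ A B)
  edgeBetweenᵇ⁺ i∈A j∈B i~j = any⁺ _ (lose i∈A (any⁺ _ (lose j∈B i~j)))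

  edgeBetweenᵇ⁻ : ∀ {A B} → T (edgeBetweenᵇ A B) → ∃₂ λ i j → i ∈ A × j ∈ B × T (adj i j)
  edgeBetweenᵇ⁻ {A} {B} t =
    let i , i∈A , t′ = find (any⁻ _ A t)
        j , j∈B , i~j = find (any⁻ _ B t′)
    in i , j , i∈A , j∈B , i~j

  ⊆blockᵇ⇒∋v : ∀ {B} → T (⊆blockᵇ V B) → v ∈ B
  ⊆blockᵇ⇒∋v V⊆B = ⊆blockᵇ⁻ V⊆B v∈V

  inside outside : List (Fin N) → List (Fin N)
  inside  S = filterᵇ (lookup V) S
  outside S = filterᵇ (not ∘ lookup V) S

  outside-⊉V : ∀ S → ⊆blockᵇ V (outside S) ≡ false
  outside-⊉V S = ¬T⇒≡false λ V⊆out →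
    T-not⁻ (proj₂ (∈-filter⁻ (T? ∘ not ∘ lookup V) {xs = S} (⊆blockᵇ⇒∋v V⊆out))) v∈V

  noEdge≡unionOfComponents : ∀ S → not (edgeBetweenᵇ (outside S) (elems V)) ≡ unionOfComponentsᵇ V S
  noEdge≡unionOfComponents S = T-ext
    (λ noEdge → unionOfComponentsᵇ⁺ {S} λ i∈V j∈S i~j → T-stable λ j∉V →
       T-not⁻ noEdge (edgeBetweenᵇ⁺ (∈-filter⁺ (T? ∘ not ∘ lookup V) j∈S (T-not⁺ j∉V))
                                    (elems⁺ {S = V} i∈V) (adj-sym i~j)))
    (λ closed → T-not⁺ λ edge →
       let j , i , j∈out , i∈V , j~i = edgeBetweenᵇ⁻ {outside S} {elems V} edge
           j∈S , j∉V = ∈-filter⁻ (T? ∘ not ∘ lookup V) {xs = S} j∈out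
       in T-not⁻ j∉V (unionOfComponentsᵇ⁻ {S} closed (elems⁻ {S = V} i∈V) j∈S (adj-sym j~i)))

  covers : List (Fin N) → Fin m → Bool
  covers B ω = any (λ i → lookup (γ i) ω) B

  EX-disjoint : ∀ A B S → (∀ ω → covers S ω ≡ covers A ω ∨ covers B ω) →
    (∀ ω → T (covers A ω) → ¬ T (covers B ω)) → EX A * EX B ≡ EX S
  EX-disjoint A B S S≡A∪B A∩B≡∅ =
    ≡-trans (Πℚ-* (allFin m) (factorOf A) (factorOf B)) (Πℚ-cong (allFin m) factor)
    where
      factorOf : List (Fin N) → Fin m → ℚ
      factorOf B ω = if covers B ω then p ω else 1ℚ
      factor : ∀ ω → factorOf A ω * factorOf B ω ≡ factorOf S ω
      factor ω rewrite S≡A∪B ω with covers A ω in a | covers B ω in b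
      ... | true  | true  = ⊥-elim (A∩B≡∅ ω (from T-≡ a) (from T-≡ b))
      ... | true  | false = *-identityʳ (p ω)
      ... | false | true  = *-identityˡ (p ω)
      ... | false | false = *-identityˡ 1ℚ

  EX-inside-outside : ∀ S → T (unionOfComponentsᵇ V S) → EX (inside S) * EX (outside S) ≡ EX S
  EX-inside-outside S closed =
    EX-disjoint (inside S) (outside S) S (λ ω → any-filter (λ i → lookup (γ i) ω) (lookup V) S) disjoint
    where
      disjoint : ∀ ω → T (covers (inside S) ω) → ¬ T (covers (outside S) ω)
      disjoint ω in-covers out-covers =
        let i , i∈in , iω = find (any⁻ _ (inside S) in-covers)
            j , j∈out , jω = find (any⁻ _ (outside S) out-covers)
            i∈V = proj₂ (∈-filter⁻ (T? ∘ lookup V) {xs = S} i∈in)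
            j∈S , j∉V = ∈-filter⁻ (T? ∘ not ∘ lookup V) {xs = S} j∈out
            i≢j : i ≢ j
            i≢j i≡j = T-not⁻ j∉V (subst InV i≡j i∈V)
        in T-not⁻ j∉V (unionOfComponentsᵇ⁻ {S} closed i∈V j∈S (adj⁺ i≢j iω jω))

  componentBlockᵇ : List (Fin N) → Bool
  componentBlockᵇ B = ⊆blockᵇ V B ∧ unionOfComponentsᵇ V B

  -- degree V π = count linkedᵇ π
  linkedᵇ : List (Fin N) → Bool
  linkedᵇ B = not (≡blockᵇ V B) ∧ edgeBetweenᵇ B (elems V)

  unlinkedWeight : List (Fin N) → List (Fin N) → ℚ
  unlinkedWeight R R' = 𝟙 (not (linkedᵇ R')) * (EX R * EX R')

  ≡blockᵇ-split : ∀ {R R' S} → (∀ y → occ y S ℕ.≤ 1) → R ++ R' ↭ S → T (⊆blockᵇ V S) →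
    ≡blockᵇ V R ≡ all (lookup V) R ∧ all (not ∘ lookup V) R'
  ≡blockᵇ-split {R} {R'} S! R++R'↭S V⊆S =
    ≡-trans (cong (_∧ all (lookup V) R) (T-ext V⊆R⇒R'∩V≡∅ R'∩V≡∅⇒V⊆R)) (∧-comm _ (all (lookup V) R))
    where
      V⊆R⇒R'∩V≡∅ : T (⊆blockᵇ V R) → T (all (not ∘ lookup V) R')
      V⊆R⇒R'∩V≡∅ V⊆R = all⁻ (not ∘ lookup V) {xs = R'} (All.tabulate λ j∈R' →
        T-not⁺ λ j∈V → split-∉ {R} {R'} S! R++R'↭S (⊆blockᵇ⁻ {R} V⊆R j∈V) j∈R')
      R'∩V≡∅⇒V⊆R : T (all (not ∘ lookup V) R') → T (⊆blockᵇ V R)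
      R'∩V≡∅⇒V⊆R R'∩V≡∅ = ⊆blockᵇ⁺ (split-⊇ R++R'↭S (⊆blockᵇ⁻ V⊆S)
        (All.map T-not⁻ (all⁺ (not ∘ lookup V) R' R'∩V≡∅)))

  -- Only the split (S ∩ V , S ∖ V) has V as first part, and it is unlinked exactly when V is a
  -- union of components of G_Γ[S]; in that case E[X_S] factors.
  Σsplits-≡blockᵇ : ∀ S → (∀ y → occ y S ℕ.≤ 1) →
    Σsplits S (λ R R' → 𝟙 (≡blockᵇ V R) * unlinkedWeight R R') ≡ 𝟙 (componentBlockᵇ S) * EX S
  Σsplits-≡blockᵇ S S! with T? (⊆blockᵇ V S)
  ... | no V⊈S = begin
    Σsplits S (λ R R' → 𝟙 (≡blockᵇ V R) * unlinkedWeight R R')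
      ≡⟨ Σsplits-cong-↭ S vanishes ⟩
    Σℚ (splits S) (λ _ → 0ℚ)
      ≡⟨ Σℚ-zero (splits S) ⟩
    0ℚ
      ≡⟨ *-zeroˡ (EX S) ⟨
    𝟙 false * EX S
      ≡⟨ cong (λ b → 𝟙 b * EX S) (¬T⇒≡false (V⊈S ∘ proj₁ ∘ to T-∧)) ⟨
    𝟙 (componentBlockᵇ S) * EX S ∎
    where
      open ≡-Reasoning
      vanishes : ∀ R R' → R ++ R' ↭ S → 𝟙 (≡blockᵇ V R) * unlinkedWeight R R' ≡ 0ℚ
      vanishes R R' R++R'↭S = ≡-trans
        (cong (λ b → 𝟙 b * unlinkedWeight R R')
          (¬T⇒≡false λ R≡V → V⊈S (⊆blockᵇ⁺ λ i∈V →
            ∈-resp-↭ R++R'↭S (∈-++⁺ˡ {ys = R'} (⊆blockᵇ⁻ {R} (proj₁ (to T-∧ R≡V)) i∈V)))))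
        (*-zeroˡ (unlinkedWeight R R'))
  ... | yes V⊆S = begin
    Σsplits S (λ R R' → 𝟙 (≡blockᵇ V R) * unlinkedWeight R R')
      ≡⟨ Σsplits-cong-↭ S (λ R R' R++R'↭S →
           cong (λ b → 𝟙 b * unlinkedWeight R R') (≡blockᵇ-split {R} {R'} S! R++R'↭S V⊆S)) ⟩
    Σsplits S (λ R R' → 𝟙 (all (lookup V) R ∧ all (not ∘ lookup V) R') * unlinkedWeight R R')
      ≡⟨ Σsplits-filter (lookup V) S unlinkedWeight ⟩
    𝟙 (not (linkedᵇ (outside S))) * (EX (inside S) * EX (outside S))
      ≡⟨ cong (λ b → 𝟙 b * (EX (inside S) * EX (outside S))) unlinked ⟩
    𝟙 (unionOfComponentsᵇ V S) * (EX (inside S) * EX (outside S))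
      ≡⟨ 𝟙-*-cong (unionOfComponentsᵇ V S) (EX-inside-outside S) ⟩
    𝟙 (unionOfComponentsᵇ V S) * EX S
      ≡⟨ cong (λ b → 𝟙 (b ∧ unionOfComponentsᵇ V S) * EX S) (to T-≡ V⊆S) ⟨
    𝟙 (componentBlockᵇ S) * EX S ∎
    where
      open ≡-Reasoning
      unlinked : not (linkedᵇ (outside S)) ≡ unionOfComponentsᵇ V S
      unlinked = ≡-trans
        (cong (λ b → not (not (b ∧ all (lookup V) (outside S)) ∧ edgeBetweenᵇ (outside S) (elems V)))
              (outside-⊉V S))
        (noEdge≡unionOfComponents S)

  κ-summand : List (List (Fin N)) → ℚ
  κ-summand π = sgn (pred (length π)) * ℕ→ℚ (pred (length π) !) * μ π

  rhs-summand : List (List (Fin N)) → ℚ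
  rhs-summand π = sgn (pred (length π)) * χ V π * μ π

  Φ-summand : List (List (Fin N)) → ℚ
  Φ-summand ρ = sgn (length ρ) * ℕ→ℚ (length ρ !) * μ ρ

  Φ : List (Fin N) → ℚ
  Φ D = Σℚ (partitions D) Φ-summand

  κ-summand-∷ : ∀ B ρ → κ-summand (B ∷ ρ) ≡ EX B * Φ-summand ρ
  κ-summand-∷ B ρ = solve 4 (λ s f e u → s :* f :* (e :* u) := e :* (s :* f :* u)) refl
    (sgn (length ρ)) (ℕ→ℚ (length ρ !)) (EX B) (μ ρ)

  μ-↭ : μ Preserves _↭_ ⟶ _≡_
  μ-↭ = Πℚ-↭ EX

  κ-summand-↭ : κ-summand Preserves _↭_ ⟶ _≡_
  κ-summand-↭ π↭π' = cong₂ (λ n u → sgn (pred n) * ℕ→ℚ (pred n !) * u) (↭-length π↭π') (μ-↭ π↭π')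

  χ-formula : ℕ → ℕ → ℚ
  χ-formula zero          _ = ℕ→ℚ 0
  χ-formula (suc zero)    _ = 1ℚ
  χ-formula (suc (suc k)) d = ℕ→ℚ d * ℕ→ℚ (k !)

  χ≡χ-formula : ∀ π → χ V π ≡ χ-formula (length π) (degree V π)
  χ≡χ-formula π with length π
  ... | zero        = refl
  ... | suc zero    = refl
  ... | suc (suc k) = refl

  rhs-summand-↭ : rhs-summand Preserves _↭_ ⟶ _≡_
  rhs-summand-↭ {π} {π'} π↭π' = begin
    rhs-summand π
      ≡⟨ cong (λ x → sgn (pred (length π)) * x * μ π) (χ≡χ-formula π) ⟩
    F (length π) (degree V π) (μ π)
      ≡⟨ cong₂ (λ n d → F n d (μ π)) (↭-length π↭π') (↭-length (filter-↭ (T? ∘ linkedᵇ) π↭π')) ⟩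
    F (length π') (degree V π') (μ π)
      ≡⟨ cong (F (length π') (degree V π')) (μ-↭ π↭π') ⟩
    F (length π') (degree V π') (μ π')
      ≡⟨ cong (λ x → sgn (pred (length π')) * x * μ π') (χ≡χ-formula π') ⟨
    rhs-summand π' ∎
    where
      open ≡-Reasoning
      F : ℕ → ℕ → ℚ → ℚ
      F n d u = sgn (pred n) * χ-formula n d * u

  κ-rooted : ∀ W → κ V W ≡ Σsplits (elems W) (λ S D → 𝟙 (componentBlockᵇ S) * EX S * Φ D)
  κ-rooted W = begin
    κ V W
      ≡⟨ Σℚ-if-𝟙 (Partitions W) (inΠCᵇ V) κ-summand ⟩
    Σℚ (Partitions W) (λ π → 𝟙 (any componentBlockᵇ π) * κ-summand π)
      ≡⟨ Σℚ-partitions-rooted (Unique-elems W) v componentBlockᵇ (λ _ → ⊆blockᵇ⇒∋v ∘ proj₁ ∘ to T-∧)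
                              κ-summand κ-summand-↭ ⟩
    Σsplits (elems W) (λ S D → Σℚ (partitions D) (λ ρ → 𝟙 (componentBlockᵇ S) * κ-summand (S ∷ ρ)))
      ≡⟨ Σsplits-cong (elems W) factorOut ⟩
    Σsplits (elems W) (λ S D → 𝟙 (componentBlockᵇ S) * EX S * Φ D) ∎
    where
      open ≡-Reasoning
      factorOut : ∀ S D → Σℚ (partitions D) (λ ρ → 𝟙 (componentBlockᵇ S) * κ-summand (S ∷ ρ)) ≡
                          𝟙 (componentBlockᵇ S) * EX S * Φ D
      factorOut S D = ≡-trans
        (Σℚ-cong (partitions D) (λ ρ → ≡-trans (cong (𝟙 (componentBlockᵇ S) *_) (κ-summand-∷ S ρ))
                                               (sym (*-assoc (𝟙 (componentBlockᵇ S)) (EX S) (Φ-summand ρ)))))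
        (sym (Σℚ-*ˡ (𝟙 (componentBlockᵇ S) * EX S) (partitions D) Φ-summand))

  rhs-rooted : ∀ W →
    rhs V W ≡ Σsplits (elems W) (λ R D → Σℚ (partitions D) (λ ρ → 𝟙 (≡blockᵇ V R) * rhs-summand (R ∷ ρ)))
  rhs-rooted W = ≡-trans (Σℚ-if-𝟙 (Partitions W) (inΠᵇ V) rhs-summand)
    (Σℚ-partitions-rooted (Unique-elems W) v (≡blockᵇ V) (λ _ → ⊆blockᵇ⇒∋v ∘ proj₁ ∘ to T-∧)
                          rhs-summand rhs-summand-↭)

  ≡blockᵇ⇒¬linkedᵇ : ∀ {R} → T (≡blockᵇ V R) → linkedᵇ R ≡ false
  ≡blockᵇ⇒¬linkedᵇ {R} R≡V = cong (λ b → not b ∧ edgeBetweenᵇ R (elems V)) (to T-≡ R≡V)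

  -- For ρ with j + 1 blocks, d of them linked to V and n = j + 1 − d not:
  -- (-1)^(j+1) d j! = (-1)^(j+1) (j+1)! + n (-1)^j j!.
  rhs-summand-∷ : ∀ {R} → T (≡blockᵇ V R) → ∀ ρ →
    rhs-summand (R ∷ ρ) ≡
    EX R * Φ-summand ρ + ℕ→ℚ (count (not ∘ linkedᵇ) ρ) * (EX R * κ-summand ρ)
  rhs-summand-∷ {R} R≡V [] =
    solve 2 (λ e k → con 1ℚ :* con 1ℚ :* (e :* con 1ℚ) :=
                      e :* (con 1ℚ :* con 1ℚ :* con 1ℚ) :+ con 0ℚ :* (e :* k))
      refl (EX R) (κ-summand [])
  rhs-summand-∷ {R} R≡V ρ@(b ∷ bs) = begin
    - sgn j * (ℕ→ℚ (degree V (R ∷ ρ)) * ℕ→ℚ (j !)) * (EX R * μ ρ)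
      ≡⟨ cong (λ k → - sgn j * (ℕ→ℚ k * ℕ→ℚ (j !)) * (EX R * μ ρ))
              (count-reject linkedᵇ ρ (≡blockᵇ⇒¬linkedᵇ {R} R≡V)) ⟩
    - sgn j * (ℕ→ℚ d * ℕ→ℚ (j !)) * (EX R * μ ρ)
      ≡⟨ solve 6 (λ s D N′ f e u → :- s :* (D :* f) :* (e :* u) :=
                    e :* (:- s :* ((D :+ N′) :* f) :* u) :+ N′ :* (e :* (s :* f :* u)))
           refl (sgn j) (ℕ→ℚ d) (ℕ→ℚ n) (ℕ→ℚ (j !)) (EX R) (μ ρ) ⟩
    EX R * (- sgn j * ((ℕ→ℚ d + ℕ→ℚ n) * ℕ→ℚ (j !)) * μ ρ) + ℕ→ℚ n * (EX R * κ-summand ρ)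
      ≡⟨ cong (λ x → EX R * (- sgn j * x * μ ρ) + ℕ→ℚ n * (EX R * κ-summand ρ)) suc-j! ⟨
    EX R * Φ-summand ρ + ℕ→ℚ n * (EX R * κ-summand ρ) ∎
    where
      open ≡-Reasoning
      j d n : ℕ
      j = length bs
      d = count linkedᵇ ρ
      n = count (not ∘ linkedᵇ) ρ
      suc-j! : ℕ→ℚ (suc j !) ≡ (ℕ→ℚ d + ℕ→ℚ n) * ℕ→ℚ (j !)
      suc-j! = begin
        ℕ→ℚ (suc j ℕ.* j !)
          ≡⟨ ℕ→ℚ-* (suc j) (j !) ⟩
        ℕ→ℚ (suc j) * ℕ→ℚ (j !)
          ≡⟨ cong (λ k → ℕ→ℚ k * ℕ→ℚ (j !)) (count-+-count-not linkedᵇ ρ) ⟨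
        ℕ→ℚ (d ℕ.+ n) * ℕ→ℚ (j !)
          ≡⟨ cong (_* ℕ→ℚ (j !)) (ℕ→ℚ-+ d n) ⟩
        (ℕ→ℚ d + ℕ→ℚ n) * ℕ→ℚ (j !) ∎

  markedWeight : List (Fin N) → List (Fin N) → List (List (Fin N)) → ℚ
  markedWeight R B r = 𝟙 (not (linkedᵇ B)) * (EX R * κ-summand (B ∷ r))

  Σmarked-markedWeight : ∀ R ρ →
    Σmarked (markedWeight R) ρ ≡
    EX R * Φ-summand ρ + ℕ→ℚ (count (not ∘ linkedᵇ) ρ) * (EX R * κ-summand ρ)
  Σmarked-markedWeight R ρ = cong₂ _+_ emptyBlock
    (≡-trans (Σpicks-↭ (𝟙 ∘ not ∘ linkedᵇ) (cong (EX R *_) ∘ κ-summand-↭) ρ)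
             (cong (_* (EX R * κ-summand ρ)) (Σℚ-𝟙 (not ∘ linkedᵇ) ρ)))
    where
      open ≡-Reasoning
      emptyBlock : markedWeight R [] ρ ≡ EX R * Φ-summand ρ
      emptyBlock = begin
        𝟙 (not (linkedᵇ [])) * (EX R * κ-summand ([] ∷ ρ))
          ≡⟨ cong (λ b → 𝟙 (not b) * (EX R * κ-summand ([] ∷ ρ))) (∧-zeroʳ (not (≡blockᵇ V []))) ⟩
        1ℚ * (EX R * κ-summand ([] ∷ ρ))
          ≡⟨ *-identityˡ _ ⟩
        EX R * κ-summand ([] ∷ ρ)
          ≡⟨ cong (EX R *_) (≡-trans (κ-summand-∷ [] ρ) (cong (_* Φ-summand ρ) (Πℚ-one (allFin m)))) ⟩
        EX R * (1ℚ * Φ-summand ρ)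
          ≡⟨ cong (EX R *_) (*-identityˡ (Φ-summand ρ)) ⟩
        EX R * Φ-summand ρ ∎

  Σℚ-partitions-rhs-summand : ∀ {R} → T (≡blockᵇ V R) → ∀ D →
    Σℚ (partitions D) (λ ρ → rhs-summand (R ∷ ρ)) ≡ Σsplits D (λ R' D' → unlinkedWeight R R' * Φ D')
  Σℚ-partitions-rhs-summand {R} R≡V D = begin
    Σℚ (partitions D) (λ ρ → rhs-summand (R ∷ ρ))
      ≡⟨ Σℚ-cong (partitions D) (λ ρ → ≡-trans (rhs-summand-∷ R≡V ρ) (sym (Σmarked-markedWeight R ρ))) ⟩
    Σℚ (partitions D) (Σmarked (markedWeight R))
      ≡⟨ Σℚ-partitions-marked D (markedWeight R) ⟩
    Σsplits D (λ R' D' → Σℚ (partitions D') (markedWeight R R'))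
      ≡⟨ Σsplits-cong D (λ R' D' → ≡-trans (Σℚ-cong (partitions D') (markedWeight-∷ R'))
                                           (sym (Σℚ-*ˡ (unlinkedWeight R R') (partitions D') Φ-summand))) ⟩
    Σsplits D (λ R' D' → unlinkedWeight R R' * Φ D') ∎
    where
      open ≡-Reasoning
      markedWeight-∷ : ∀ R' ρ → markedWeight R R' ρ ≡ unlinkedWeight R R' * Φ-summand ρ
      markedWeight-∷ R' ρ = ≡-trans (cong (λ x → 𝟙 (not (linkedᵇ R')) * (EX R * x)) (κ-summand-∷ R' ρ))
        (solve 4 (λ a e e′ u → a :* (e :* (e′ :* u)) := a :* (e :* e′) :* u) refl
          (𝟙 (not (linkedᵇ R'))) (EX R) (EX R') (Φ-summand ρ))

  tripleSum : List (Fin N) → ℚ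
  tripleSum U =
    Σsplits U (λ R D → Σsplits D (λ R' D' → 𝟙 (≡blockᵇ V R) * (unlinkedWeight R R' * Φ D')))

  κ≡tripleSum : ∀ W → κ V W ≡ tripleSum (elems W)
  κ≡tripleSum W = begin
    κ V W
      ≡⟨ κ-rooted W ⟩
    Σsplits U (λ S D → 𝟙 (componentBlockᵇ S) * EX S * Φ D)
      ≡⟨ Σsplits-cong-↭ U expand ⟩
    Σsplits U (λ S D → Σsplits S (λ R R' → 𝟙 (≡blockᵇ V R) * (unlinkedWeight R R' * Φ D)))
      ≡⟨ Σsplits-assoc U (λ R R' D → 𝟙 (≡blockᵇ V R) * (unlinkedWeight R R' * Φ D)) ⟨
    tripleSum U ∎
    where
      open ≡-Reasoning
      U : List (Fin N)
      U = elems W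
      expand : ∀ S D → S ++ D ↭ U → 𝟙 (componentBlockᵇ S) * EX S * Φ D ≡
               Σsplits S (λ R R' → 𝟙 (≡blockᵇ V R) * (unlinkedWeight R R' * Φ D))
      expand S D S++D↭U = begin
        𝟙 (componentBlockᵇ S) * EX S * Φ D
          ≡⟨ cong (_* Φ D) (Σsplits-≡blockᵇ S S!) ⟨
        Σsplits S (λ R R' → 𝟙 (≡blockᵇ V R) * unlinkedWeight R R') * Φ D
          ≡⟨ Σℚ-*ʳ (Φ D) (splits S) (uncurry (λ R R' → 𝟙 (≡blockᵇ V R) * unlinkedWeight R R')) ⟩
        Σsplits S (λ R R' → 𝟙 (≡blockᵇ V R) * unlinkedWeight R R' * Φ D)
          ≡⟨ Σsplits-cong S (λ R R' → *-assoc (𝟙 (≡blockᵇ V R)) (unlinkedWeight R R') (Φ D)) ⟩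
        Σsplits S (λ R R' → 𝟙 (≡blockᵇ V R) * (unlinkedWeight R R' * Φ D)) ∎
        where
          S! : ∀ y → occ y S ℕ.≤ 1
          S! y = ℕ.≤-trans (occ-split {S} {D} S++D↭U y) (Unique⇒occ≤1 (Unique-elems W) y)

  rhs≡tripleSum : ∀ W → rhs V W ≡ tripleSum (elems W)
  rhs≡tripleSum W = ≡-trans (rhs-rooted W) (Σsplits-cong (elems W) factorOut)
    where
      factorOut : ∀ R D → Σℚ (partitions D) (λ ρ → 𝟙 (≡blockᵇ V R) * rhs-summand (R ∷ ρ)) ≡
                          Σsplits D (λ R' D' → 𝟙 (≡blockᵇ V R) * (unlinkedWeight R R' * Φ D'))
      factorOut R D = ≡-trans (sym (Σℚ-*ˡ (𝟙 (≡blockᵇ V R)) (partitions D) (λ ρ → rhs-summand (R ∷ ρ))))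
        (≡-trans (𝟙-*-cong (≡blockᵇ V R) (λ R≡V → Σℚ-partitions-rhs-summand R≡V D))
                 (Σℚ-*ˡ (𝟙 (≡blockᵇ V R)) (splits D) (uncurry (λ R' D' → unlinkedWeight R R' * Φ D'))))

-- The identity holds for every γ and p, and if V ⊈ W both sides vanish.
lemma3p9 : {m N : ℕ} (γ : Fin N → Subset m) → Injective _≡_ _≡_ γ →
    (p : Fin m → ℚ) → (∀ ω → (0ℚ < p ω) × (p ω < 1ℚ)) →
    (V W : Subset N) → Nonempty V → V ⊆ W →
    Hypergraph.κ γ p V W ≡ Hypergraph.rhs γ p V W
lemma3p9 γ _ p _ V W (v , v∈V) _ = ≡-trans (κ≡tripleSum W) (sym (rhs≡tripleSum W))
  where open Rooted γ p V (from T-≡ ([]=⇒lookup v∈V))
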